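{- Let $m,r$ be parameters and let $D$ be the formal derivative associated with the grammar $G=\{x\rightarrow rx+xy,\ y\rightarrow my\}$. Then for all $n\geq 1$, $$D^n(x)=x\,D_{m,r}(n;y),$$ where $D_{m,r}(n;y)=\sum_{k=0}^n W_{m,r}(n,k)\,y^k$ is the $r$-Dowling polynomial.
   Context: The formal derivative of a grammar $\{x\rightarrow f,\ y\rightarrow g\}$ is the unique derivation $D$ (linear, with $D(uv)=D(u)v+uD(v)$) of the polynomial ring in $x,y$ over a coefficient ring containing $m,r$, with $D(x)=f$, $D(y)=g$. The $r$-Whitney numbers of the second kind $W_{m,r}(n,k)$ are defined by $(mt+r)^n=\sum_{k=0}^n m^k W_{m,r}(n,k)\,t^{\underline{k}}$ with $t^{\underline{k}}=t(t-1)\cdots(t-k+1)$; equivalently, $W_{m,r}(1,0)=r$, $W_{m,r}(1,1)=1$, $W_{m,r}(1,k)=0$ for $k\geq 2$ (and $W_{m,r}(n,k)=0$ for $k<0$ or $k>n$), and $W_{m,r}(n,k)=(r+km)W_{m,r}(n-1,k)+W_{m,r}(n-1,k-1)$ for $n\geq 2$. -}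

module Defs where

open import Level using (Level)
open import Algebra.Bundles using (CommutativeRing)
open import Data.Nat using (ℕ; zero; suc; _∸_; _≤?_)
open import Relation.Nullary using (yes; no)
open import Function using (_∘_)

-- Bivariate polynomials in x, y over a commutative ring R, represented by
-- their coefficient functions: P a b is the coefficient of x^a y^b.
module PolyDefs {c ℓ : Level} (R : CommutativeRing c ℓ) where
  open CommutativeRing R using (Carrier; _≈_; _+_; _*_; 0#; 1#)

  Poly : Set c
  Poly = ℕ → ℕ → Carrier

  _≋_ : Poly → Poly → Set ℓ
  P ≋ Q = ∀ a b → P a b ≈ Q a b

  _·ℕ_ : ℕ → Carrier → Carrier
  zero  ·ℕ x = 0#
  suc n ·ℕ x = x + n ·ℕ x

  sumTo : ℕ → (ℕ → Carrier) → Carrier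
  sumTo zero    f = f zero
  sumTo (suc n) f = sumTo n f + f (suc n)

  const : Carrier → Poly
  const k zero zero = k
  const k _    _    = 0#

  X : Poly
  X (suc zero) zero = 1#
  X _          _    = 0#

  Y : Poly
  Y zero (suc zero) = 1#
  Y _    _          = 0#

  _+ₚ_ : Poly → Poly → Poly
  (P +ₚ Q) a b = P a b + Q a b

  _·ₚ_ : Carrier → Poly → Poly
  (k ·ₚ P) a b = k * P a b

  _*ₚ_ : Poly → Poly → Poly
  (P *ₚ Q) a b = sumTo a λ i → sumTo b λ j → P i j * Q (a ∸ i) (b ∸ j)

  ∂x : Poly → Poly
  ∂x P a b = suc a ·ℕ P (suc a) b

  ∂y : Poly → Poly
  ∂y P a b = suc b ·ℕ P a (suc b)

  -- The formal derivative of the grammar {x → f, y → g}: the unique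
  -- derivation D with D x = f, D y = g, namely D = f ∂/∂x + g ∂/∂y.
  grammarD : Poly → Poly → Poly → Poly
  grammarD f g P = (∂x P *ₚ f) +ₚ (∂y P *ₚ g)

  iterate : ℕ → (Poly → Poly) → Poly → Poly
  iterate zero    F P = P
  iterate (suc n) F P = F (iterate n F P)

  -- r-Whitney numbers of the second kind W_{m,r}(n,k), as in the paper
  -- (base case n = 1, recursion for n ≥ 2; W(0,k) is not used and set to 0).
  W : (m r : Carrier) → ℕ → ℕ → Carrier
  W m r zero          k             = 0#
  W m r (suc zero)    zero          = r
  W m r (suc zero)    (suc zero)    = 1#
  W m r (suc zero)    (suc (suc k)) = 0#
  W m r (suc (suc n)) zero          = (r + zero ·ℕ m) * W m r (suc n) zero
  W m r (suc (suc n)) (suc k)       =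
    (r + suc k ·ℕ m) * W m r (suc n) (suc k) + W m r (suc n) k

  dowling : (m r : Carrier) → ℕ → Poly
  dowling m r n zero k with k ≤? n
  ... | yes _ = W m r n k
  ... | no  _ = 0#
  dowling m r n (suc a) k = 0#

  DG : (m r : Carrier) → Poly → Poly
  DG m r = grammarD ((r ·ₚ X) +ₚ (X *ₚ Y)) (m ·ₚ Y)

module Submission where

-- Call a polynomial x-linear if it has the form x·q(y) for a
-- coefficient sequence q.  For a grammar {x → x·φ(y), y → γ(y)} the formal
-- derivative maps x·q(y) to x·(q(y)φ(y) + q'(y)γ(y)), so x-linear polynomials
-- are closed under D and D acts on the sequence q alone.  For the grammar
-- G = {x → rx + xy, y → my} we have φ = r + y and γ = my, hence the coefficient
-- of y^k in D(x·q(y)) is (r + km)·q_k + q_{k-1}: exactly the recursion of the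
-- r-Whitney numbers.  Starting from x = x·1, induction on n gives
-- D^n(x) = x·Σ_k W_{m,r}(n,k) y^k, and since W_{m,r}(n,k) = 0 for k > n this is
-- x·D_{m,r}(n;y).

open import Defs
open import Level using (Level)
open import Algebra.Bundles using (CommutativeRing)
open import Data.Nat using (ℕ; _≤_; _<_; zero; suc; _∸_; _≤?_; s≤s; z≤n)
open import Data.Nat.Properties using (≤-refl; m≤n⇒m≤1+n; ≰⇒>; n∸n≡0; m+n∸n≡m)
open import Relation.Nullary using (yes; no)
open import Data.Maybe using (nothing)
open import Relation.Binary.PropositionalEquality using (_≡_) renaming (cong to ≡-cong; refl to ≡-refl)
open import Tactic.RingSolver using (solve-∀)
open import Tactic.RingSolver.Core.AlmostCommutativeRing using (fromCommutativeRing; AlmostCommutativeRing)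

-- The ring identity behind the Whitney recursion, checked by the ring solver:
-- in the coefficient of y^(b+1), N stands for the multiple (b+1)·1.
module WhitneyIdentity {c ℓ : Level} (R : CommutativeRing c ℓ) where
  ring : AlmostCommutativeRing c ℓ
  ring = fromCommutativeRing R (λ _ → nothing)
  open AlmostCommutativeRing ring

  higher-coefficient : ∀ q₁ q₀ r m N → (q₀ + q₁ * r) + (N * q₁) * m ≈ (r + N * m) * q₁ + q₀
  higher-coefficient = solve-∀ ring

module Dowling {c ℓ : Level} (R : CommutativeRing c ℓ) where
  open CommutativeRing R hiding (zero)
  open PolyDefs R
  open import Relation.Binary.Reasoning.Setoid setoid
  open WhitneyIdentity R

  ≋-refl : ∀ {P} → P ≋ P
  ≋-refl a b = refl

  ≋-sym : ∀ {P Q} → P ≋ Q → Q ≋ P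
  ≋-sym P≋Q a b = sym (P≋Q a b)

  ≋-trans : ∀ {P Q S} → P ≋ Q → Q ≋ S → P ≋ S
  ≋-trans P≋Q Q≋S a b = trans (P≋Q a b) (Q≋S a b)

  -- Natural-number multiples n·x: congruence, n·0 = 0, and n·x = (n·1)x,
  -- the last one turning multiples into ring products for the solver.
  ·ℕ-cong : ∀ n {x y} → x ≈ y → n ·ℕ x ≈ n ·ℕ y
  ·ℕ-cong zero    _   = refl
  ·ℕ-cong (suc n) x≈y = +-cong x≈y (·ℕ-cong n x≈y)

  ·ℕ-zeroʳ : ∀ n → n ·ℕ 0# ≈ 0#
  ·ℕ-zeroʳ zero    = refl
  ·ℕ-zeroʳ (suc n) = trans (+-identityˡ _) (·ℕ-zeroʳ n)

  ·ℕ-as-* : ∀ n x → n ·ℕ x ≈ (n ·ℕ 1#) * x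
  ·ℕ-as-* zero    x = sym (zeroˡ x)
  ·ℕ-as-* (suc n) x = begin
    x + n ·ℕ x                  ≈⟨ +-cong (sym (*-identityˡ x)) (·ℕ-as-* n x) ⟩
    1# * x + (n ·ℕ 1#) * x      ≈⟨ sym (distribʳ x 1# (n ·ℕ 1#)) ⟩
    (1# + n ·ℕ 1#) * x          ∎

  sumTo-cong : ∀ n {f g : ℕ → Carrier} → (∀ i → f i ≈ g i) → sumTo n f ≈ sumTo n g
  sumTo-cong zero    f≈g = f≈g zero
  sumTo-cong (suc n) f≈g = +-cong (sumTo-cong n f≈g) (f≈g (suc n))

  sumTo-zero : ∀ n (f : ℕ → Carrier) → (∀ i → i ≤ n → f i ≈ 0#) → sumTo n f ≈ 0#
  sumTo-zero zero    f f≈0 = f≈0 zero z≤n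
  sumTo-zero (suc n) f f≈0 = trans
    (+-cong (sumTo-zero n f (λ i i≤n → f≈0 i (m≤n⇒m≤1+n i≤n))) (f≈0 (suc n) ≤-refl))
    (+-identityˡ 0#)

  sumTo-head : ∀ n (f : ℕ → Carrier) → (∀ i → f (suc i) ≈ 0#) → sumTo n f ≈ f 0
  sumTo-head zero    f tail≈0 = refl
  sumTo-head (suc n) f tail≈0 = trans (+-cong (sumTo-head n f tail≈0) (tail≈0 n)) (+-identityʳ _)

  sumTo-last : ∀ n (f : ℕ → Carrier) → (∀ i → i < n → f i ≈ 0#) → sumTo n f ≈ f n
  sumTo-last zero    f init≈0 = refl
  sumTo-last (suc n) f init≈0 =
    trans (+-cong (sumTo-zero n f (λ i i≤n → init≈0 i (s≤s i≤n))) refl) (+-identityˡ _)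

  +ₚ-cong : ∀ {P P′ Q Q′} → P ≋ P′ → Q ≋ Q′ → (P +ₚ Q) ≋ (P′ +ₚ Q′)
  +ₚ-cong P≋P′ Q≋Q′ a b = +-cong (P≋P′ a b) (Q≋Q′ a b)

  *ₚ-cong : ∀ {P P′ Q Q′} → P ≋ P′ → Q ≋ Q′ → (P *ₚ Q) ≋ (P′ *ₚ Q′)
  *ₚ-cong P≋P′ Q≋Q′ a b =
    sumTo-cong a (λ i → sumTo-cong b (λ j → *-cong (P≋P′ i j) (Q≋Q′ (a ∸ i) (b ∸ j))))

  ∂x-cong : ∀ {P Q} → P ≋ Q → ∂x P ≋ ∂x Q
  ∂x-cong P≋Q a b = ·ℕ-cong (suc a) (P≋Q (suc a) b)

  ∂y-cong : ∀ {P Q} → P ≋ Q → ∂y P ≋ ∂y Q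
  ∂y-cong P≋Q a b = ·ℕ-cong (suc b) (P≋Q a (suc b))

  Seq : Set c
  Seq = ℕ → Carrier

  _⋆_ : Seq → Seq → Seq
  (u ⋆ v) b = sumTo b (λ j → u j * v (b ∸ j))

  δ₀ : Seq
  δ₀ zero    = 1#
  δ₀ (suc _) = 0#

  δ₁ : Seq
  δ₁ (suc zero) = 1#
  δ₁ _          = 0#

  ⋆-identityˡ : ∀ v b → (δ₀ ⋆ v) b ≈ v b
  ⋆-identityˡ v b = trans (sumTo-head b (λ j → δ₀ j * v (b ∸ j)) (λ i → zeroˡ _)) (*-identityˡ (v b))

  ⋆-linear : ∀ u v → (∀ k → v (suc (suc k)) ≈ 0#) → ∀ b →
             (u ⋆ v) (suc b) ≈ u b * v 1 + u (suc b) * v 0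
  ⋆-linear u v deg≤1 b =
    +-cong (trans (sumTo-last b term early≈0) (*-cong refl (reflexive (≡-cong v (m+n∸n≡m 1 b)))))
           (*-cong refl (reflexive (≡-cong v (n∸n≡0 b))))
    where
    term : ℕ → Carrier
    term j = u j * v (suc b ∸ j)

    -- In the terms j < b, v is evaluated at an index ≥ 2, where it vanishes.
    suc-∸-early : ∀ i b → i < b → suc b ∸ i ≡ suc (suc (b ∸ suc i))
    suc-∸-early zero    (suc b) _         = ≡-refl
    suc-∸-early (suc i) (suc b) (s≤s i<b) = suc-∸-early i b i<b

    early≈0 : ∀ i → i < b → term i ≈ 0#
    early≈0 i i<b = trans (*-cong refl (trans (reflexive (≡-cong v (suc-∸-early i b i<b))) (deg≤1 _)))
                          (zeroʳ _)

  derivative : Seq → Seq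
  derivative q b = suc b ·ℕ q (suc b)

  inY : Seq → Poly
  inY q zero    b = q b
  inY q (suc _) b = 0#

  xTimes : Seq → Poly
  xTimes q (suc zero) b = q b
  xTimes q _          b = 0#

  xTimes-cong : ∀ {p q} → (∀ b → p b ≈ q b) → xTimes p ≋ xTimes q
  xTimes-cong p≈q zero          b = refl
  xTimes-cong p≈q (suc zero)    b = p≈q b
  xTimes-cong p≈q (suc (suc a)) b = refl

  xTimes-+ : ∀ p q → (xTimes p +ₚ xTimes q) ≋ xTimes (λ b → p b + q b)
  xTimes-+ p q zero          b = +-identityˡ 0#
  xTimes-+ p q (suc zero)    b = refl
  xTimes-+ p q (suc (suc a)) b = +-identityˡ 0#

  inY-*-xTimes : ∀ q p → (inY q *ₚ xTimes p) ≋ xTimes (q ⋆ p)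
  inY-*-xTimes q p a b = trans
    (sumTo-head a (λ i → sumTo b (λ j → inY q i j * xTimes p (a ∸ i) (b ∸ j)))
                  (λ i → sumTo-zero b _ (λ j _ → zeroˡ _)))
    (first-row a)
    where
    first-row : ∀ a → sumTo b (λ j → q j * xTimes p a (b ∸ j)) ≈ xTimes (q ⋆ p) a b
    first-row zero          = sumTo-zero b _ (λ j _ → zeroʳ _)
    first-row (suc zero)    = refl
    first-row (suc (suc a)) = sumTo-zero b _ (λ j _ → zeroʳ _)

  xTimes-*-inY : ∀ u v → (xTimes u *ₚ inY v) ≋ xTimes (u ⋆ v)
  xTimes-*-inY u v zero          b = sumTo-zero b _ (λ j _ → zeroˡ _)
  xTimes-*-inY u v (suc zero)    b = trans (+-cong (sumTo-zero b _ (λ j _ → zeroˡ _)) refl) (+-identityˡ _)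
  xTimes-*-inY u v (suc (suc a)) b = sumTo-zero (suc (suc a)) _ (λ i _ → row≈0 i)
    where
    row≈0 : ∀ i → sumTo b (λ j → xTimes u i j * inY v (suc (suc a) ∸ i) (b ∸ j)) ≈ 0#
    row≈0 zero          = sumTo-zero b _ (λ j _ → zeroˡ _)
    row≈0 (suc zero)    = sumTo-zero b _ (λ j _ → zeroʳ _)
    row≈0 (suc (suc i)) = sumTo-zero b _ (λ j _ → zeroˡ _)

  ∂x-xTimes : ∀ q → ∂x (xTimes q) ≋ inY q
  ∂x-xTimes q zero    b = +-identityʳ _
  ∂x-xTimes q (suc a) b = ·ℕ-zeroʳ (suc (suc a))

  ∂y-xTimes : ∀ q → ∂y (xTimes q) ≋ xTimes (derivative q)
  ∂y-xTimes q zero          b = ·ℕ-zeroʳ (suc b)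
  ∂y-xTimes q (suc zero)    b = refl
  ∂y-xTimes q (suc (suc a)) b = ·ℕ-zeroʳ (suc b)

  grammarD-cong : ∀ f g {P Q} → P ≋ Q → grammarD f g P ≋ grammarD f g Q
  grammarD-cong f g P≋Q =
    +ₚ-cong (*ₚ-cong {Q = f} (∂x-cong P≋Q) ≋-refl) (*ₚ-cong {Q = g} (∂y-cong P≋Q) ≋-refl)

  grammarD-xTimes : ∀ φ γ q →
    grammarD (xTimes φ) (inY γ) (xTimes q) ≋ xTimes (λ b → (q ⋆ φ) b + (derivative q ⋆ γ) b)
  grammarD-xTimes φ γ q a b = begin
    grammarD (xTimes φ) (inY γ) (xTimes q) a b
      ≈⟨ +ₚ-cong (*ₚ-cong (∂x-xTimes q) (≋-refl {xTimes φ})) (*ₚ-cong (∂y-xTimes q) (≋-refl {inY γ})) a b ⟩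
    (inY q *ₚ xTimes φ) a b + (xTimes (derivative q) *ₚ inY γ) a b
      ≈⟨ +-cong (inY-*-xTimes q φ a b) (xTimes-*-inY (derivative q) γ a b) ⟩
    (xTimes (q ⋆ φ) +ₚ xTimes (derivative q ⋆ γ)) a b
      ≈⟨ xTimes-+ (q ⋆ φ) (derivative q ⋆ γ) a b ⟩
    xTimes (λ b → (q ⋆ φ) b + (derivative q ⋆ γ) b) a b ∎

  module GrammarG (m r : Carrier) where

    φG : Seq
    φG b = r * δ₀ b + δ₁ b

    γG : Seq
    γG b = m * δ₁ b

    φG-0 : φG 0 ≈ r
    φG-0 = trans (+-identityʳ _) (*-identityʳ r)

    φG-1 : φG 1 ≈ 1#
    φG-1 = trans (+-cong (zeroʳ r) refl) (+-identityˡ 1#)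

    γG-0 : γG 0 ≈ 0#
    γG-0 = zeroʳ m

    γG-1 : γG 1 ≈ m
    γG-1 = *-identityʳ m

    X≋xTimes-δ₀ : X ≋ xTimes δ₀
    X≋xTimes-δ₀ zero          b       = refl
    X≋xTimes-δ₀ (suc zero)    zero    = refl
    X≋xTimes-δ₀ (suc zero)    (suc b) = refl
    X≋xTimes-δ₀ (suc (suc a)) b       = refl

    Y≋inY-δ₁ : Y ≋ inY δ₁
    Y≋inY-δ₁ zero    zero          = refl
    Y≋inY-δ₁ zero    (suc zero)    = refl
    Y≋inY-δ₁ zero    (suc (suc b)) = refl
    Y≋inY-δ₁ (suc a) b             = refl

    XY≋xTimes-δ₁ : (X *ₚ Y) ≋ xTimes δ₁
    XY≋xTimes-δ₁ a b = begin
      (X *ₚ Y) a b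
        ≈⟨ *ₚ-cong X≋xTimes-δ₀ Y≋inY-δ₁ a b ⟩
      (xTimes δ₀ *ₚ inY δ₁) a b
        ≈⟨ xTimes-*-inY δ₀ δ₁ a b ⟩
      xTimes (δ₀ ⋆ δ₁) a b
        ≈⟨ xTimes-cong (⋆-identityˡ δ₁) a b ⟩
      xTimes δ₁ a b ∎

    rX+XY≋xTimes-φG : ((r ·ₚ X) +ₚ (X *ₚ Y)) ≋ xTimes φG
    rX+XY≋xTimes-φG zero          b = trans (+-cong (zeroʳ r) (XY≋xTimes-δ₁ zero b)) (+-identityˡ 0#)
    rX+XY≋xTimes-φG (suc zero)    b = +-cong (*-cong refl (X≋xTimes-δ₀ 1 b)) (XY≋xTimes-δ₁ 1 b)
    rX+XY≋xTimes-φG (suc (suc a)) b = trans (+-cong (zeroʳ r) (XY≋xTimes-δ₁ (suc (suc a)) b)) (+-identityˡ 0#)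

    mY≋inY-γG : (m ·ₚ Y) ≋ inY γG
    mY≋inY-γG zero    b = *-cong refl (Y≋inY-δ₁ zero b)
    mY≋inY-γG (suc a) b = zeroʳ m

    shift : Seq → Seq
    shift q zero    = 0#
    shift q (suc b) = q b

    whitneyStep : Seq → Seq
    whitneyStep q b = (r + b ·ℕ m) * q b + shift q b

    whitney-coefficient : ∀ q b → (q ⋆ φG) b + (derivative q ⋆ γG) b ≈ whitneyStep q b
    whitney-coefficient q zero    = begin
      q 0 * φG 0 + derivative q 0 * γG 0  ≈⟨ +-cong (*-cong refl φG-0) (trans (*-cong refl γG-0) (zeroʳ _)) ⟩
      q 0 * r + 0#                        ≈⟨ +-cong (trans (*-comm (q 0) r) (*-cong (sym (+-identityʳ r)) refl)) refl ⟩
      whitneyStep q 0                     ∎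
    whitney-coefficient q (suc b) = begin
      (q ⋆ φG) (suc b) + (derivative q ⋆ γG) (suc b)
        ≈⟨ +-cong (⋆-linear q φG (λ k → trans (+-identityʳ _) (zeroʳ r)) b)
                  (⋆-linear (derivative q) γG (λ k → zeroʳ m) b) ⟩
      (q b * φG 1 + q (suc b) * φG 0) + (derivative q b * γG 1 + derivative q (suc b) * γG 0)
        ≈⟨ +-cong (+-cong (trans (*-cong refl φG-1) (*-identityʳ _)) (*-cong refl φG-0))
                  (trans (+-cong (*-cong (·ℕ-as-* (suc b) (q (suc b))) γG-1)
                                 (trans (*-cong refl γG-0) (zeroʳ _)))
                         (+-identityʳ _)) ⟩
      (q b + q (suc b) * r) + ((suc b ·ℕ 1#) * q (suc b)) * m
        ≈⟨ higher-coefficient (q (suc b)) (q b) r m (suc b ·ℕ 1#) ⟩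
      (r + (suc b ·ℕ 1#) * m) * q (suc b) + q b
        ≈⟨ +-cong (*-cong (+-cong refl (sym (·ℕ-as-* (suc b) m))) refl) refl ⟩
      whitneyStep q (suc b) ∎

    DG-xTimes : ∀ q → DG m r (xTimes q) ≋ xTimes (whitneyStep q)
    DG-xTimes q a b = begin
      DG m r (xTimes q) a b
        ≈⟨ +ₚ-cong (*ₚ-cong (≋-refl {∂x (xTimes q)}) rX+XY≋xTimes-φG)
                   (*ₚ-cong (≋-refl {∂y (xTimes q)}) mY≋inY-γG) a b ⟩
      grammarD (xTimes φG) (inY γG) (xTimes q) a b
        ≈⟨ grammarD-xTimes φG γG q a b ⟩
      xTimes (λ b → (q ⋆ φG) b + (derivative q ⋆ γG) b) a b
        ≈⟨ xTimes-cong (whitney-coefficient q) a b ⟩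
      xTimes (whitneyStep q) a b ∎

    whitneyStep-δ₀ : ∀ b → whitneyStep δ₀ b ≈ W m r 1 b
    whitneyStep-δ₀ zero          = trans (+-identityʳ _) (trans (*-identityʳ _) (+-identityʳ r))
    whitneyStep-δ₀ (suc zero)    = trans (+-cong (zeroʳ _) refl) (+-identityˡ _)
    whitneyStep-δ₀ (suc (suc b)) = trans (+-identityʳ _) (zeroʳ _)

    whitneyStep-W : ∀ n b → whitneyStep (W m r (suc n)) b ≈ W m r (suc (suc n)) b
    whitneyStep-W n zero    = +-identityʳ _
    whitneyStep-W n (suc b) = refl

    -- W(n,k) = 0 for k > n, so the Dowling polynomial lists all of W(n,·).
    W-vanishes : ∀ n k → n < k → W m r n k ≈ 0#
    W-vanishes zero          k             _          = refl
    W-vanishes (suc zero)    (suc zero)    (s≤s ())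
    W-vanishes (suc zero)    (suc (suc k)) _          = refl
    W-vanishes (suc (suc n)) (suc k)       (s≤s n<k) = trans
      (+-cong (trans (*-cong refl (W-vanishes (suc n) (suc k) (m≤n⇒m≤1+n n<k))) (zeroʳ _))
              (W-vanishes (suc n) k n<k))
      (+-identityʳ 0#)

    dowling-coefficient : ∀ n b → dowling m r n zero b ≈ W m r n b
    dowling-coefficient n b with b ≤? n
    ... | yes _   = refl
    ... | no  b≰n = sym (W-vanishes n b (≰⇒> b≰n))

    dowling-inY : ∀ n → dowling m r n ≋ inY (dowling m r n zero)
    dowling-inY n zero    b = refl
    dowling-inY n (suc a) b = refl

    X*dowling : ∀ n → (X *ₚ dowling m r n) ≋ xTimes (W m r n)
    X*dowling n a b = begin
      (X *ₚ dowling m r n) a b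
        ≈⟨ *ₚ-cong X≋xTimes-δ₀ (dowling-inY n) a b ⟩
      (xTimes δ₀ *ₚ inY (dowling m r n zero)) a b
        ≈⟨ xTimes-*-inY δ₀ (dowling m r n zero) a b ⟩
      xTimes (δ₀ ⋆ dowling m r n zero) a b
        ≈⟨ xTimes-cong (λ b → trans (⋆-identityˡ (dowling m r n zero) b) (dowling-coefficient n b)) a b ⟩
      xTimes (W m r n) a b ∎

    DG-cong : ∀ {P Q} → P ≋ Q → DG m r P ≋ DG m r Q
    DG-cong = grammarD-cong ((r ·ₚ X) +ₚ (X *ₚ Y)) (m ·ₚ Y)

    iterate-DG-X : ∀ n → iterate (suc n) (DG m r) X ≋ xTimes (W m r (suc n))
    iterate-DG-X zero    = ≋-trans (DG-cong X≋xTimes-δ₀)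
                             (≋-trans (DG-xTimes δ₀) (xTimes-cong whitneyStep-δ₀))
    iterate-DG-X (suc n) = ≋-trans (DG-cong (iterate-DG-X n))
                             (≋-trans (DG-xTimes (W m r (suc n))) (xTimes-cong (whitneyStep-W n)))

mainTheorem6 : ∀ {c ℓ : Level} (R : CommutativeRing c ℓ) (m r : CommutativeRing.Carrier R) (n : ℕ) →
    1 ≤ n → let open PolyDefs R in iterate n (DG m r) X ≋ (X *ₚ dowling m r n)
mainTheorem6 R m r (suc n) _ = ≋-trans (iterate-DG-X n) (≋-sym (X*dowling (suc n)))
  where
  open Dowling R
  open GrammarG m r
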